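{- For every integer $g > 6$ there exists $\delta_0$ such that every finite simple graph $G$ with girth $g$ and minimum degree $\delta > \delta_0$ satisfies $(g-3)(\delta-2) + \delta \le Z(G)$ (independently of the number of vertices of $G$).
   Context: The girth is the length of a shortest cycle. Zero forcing process: start with an initial set $S$ of colored vertices. A colored vertex $u$ forces an uncolored neighbor $w$ (making $w$ colored) if $w$ is the only uncolored neighbor of $u$; forces are applied repeatedly. $S$ is a zero forcing set if eventually every vertex becomes colored. $Z(G)$ is the minimum size of a zero forcing set. -}

module Defs where

open import Data.Nat using (ℕ; zero; suc; _≤_; _<_; _+_; _*_; _∸_)
open import Data.Bool using (Bool; true; false; T)
open import Data.Fin using (Fin)
open import Data.Fin.Subset using (Subset; _∈_; ∣_∣)
open import Data.List using (List; []; _∷_; length; filter; allFin)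
open import Data.List.Relation.Unary.Unique.Propositional using (Unique)
open import Data.List.Relation.Unary.Linked using (Linked)
open import Data.Product using (Σ; _×_; ∃; ∃-syntax)
open import Relation.Binary.PropositionalEquality using (_≡_; _≢_)
open import Relation.Nullary using (¬_)

record Graph (n : ℕ) : Set where
  field
    adj   : Fin n → Fin n → Bool
    sym   : ∀ u v → adj u v ≡ adj v u
    loopless : ∀ v → adj v v ≡ false

module _ {n : ℕ} (G : Graph n) where
  open Graph G

  Adj : Fin n → Fin n → Set
  Adj u v = T (adj u v)

  degree : Fin n → ℕ
  degree v = length (filter (λ w → T? (adj v w)) (allFin n))
    where
    open import Relation.Nullary.Decidable using () renaming (T? to T?)

  MinDegree : ℕ → Set
  MinDegree δ = (∀ v → δ ≤ degree v) × (∃[ v ] degree v ≡ δ)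

  lastOf : Fin n → List (Fin n) → Fin n
  lastOf v []       = v
  lastOf v (w ∷ ws) = lastOf w ws

  -- A cycle v ∷ vs: distinct vertices, at least 3 of them, consecutive
  -- ones adjacent, and the last adjacent to the first.  Its length is
  -- the number of vertices (= number of edges).
  record Cycle (k : ℕ) : Set where
    field
      start    : Fin n
      rest     : List (Fin n)
      len      : length (start ∷ rest) ≡ k
      long     : 3 ≤ k
      distinct : Unique (start ∷ rest)
      path     : Linked Adj (start ∷ rest)
      closing  : Adj (lastOf start rest) start

  HasGirth : ℕ → Set
  HasGirth g = Cycle g × (∀ k → k < g → ¬ Cycle k)

  -- Vertices that eventually become coloured in the zero forcing process
  -- started from S (inductive closure under the colour-change rule).
  data Coloured (S : Subset n) : Fin n → Set where
    initial : ∀ {v} → v ∈ S → Coloured S v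
    force   : ∀ {u w} → Coloured S u → Adj u w →
              (∀ x → Adj u x → x ≢ w → Coloured S x) →
              Coloured S w

  ZeroForcingSet : Subset n → Set
  ZeroForcingSet S = ∀ v → Coloured S v

  IsZeroForcingNumber : ℕ → Set
  IsZeroForcingNumber z =
    (∃[ S ] (ZeroForcingSet S × ∣ S ∣ ≡ z)) ×
    (∀ S → ZeroForcingSet S → z ≤ ∣ S ∣)

-- Let S be a zero forcing set of G and run the colour-change
-- process.  Every force u → w leaves the whole closed neighbourhood
-- N[u] coloured, and the forcing vertices are pairwise distinct.  After
-- m forces at most ∣S∣ + m vertices are coloured, and they include the
-- closed neighbourhoods of m distinct vertices.  If G has no 3- or
-- 4-cycles, two distinct closed neighbourhoods share at most two
-- vertices, so these m sets (each of size ≥ δ + 1) cover at least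
-- m (δ + 1) − m² vertices.  Hence m δ ≤ ∣S∣ + m² for every m ≤ n, and
-- the choice m = g − 1 together with δ > g² yields the theorem.
module Submission where

open import Defs
open import Data.Bool using (Bool; true; false; T)
open import Data.Bool.Properties using (T-≡)
open import Data.Empty using (⊥; ⊥-elim)
open import Data.Fin using (Fin; zero; suc; _≟_)
open import Data.Fin.Properties using (any?)
open import Data.Fin.Subset
  using (Subset; inside; outside; _∈_; _∉_; _⊆_; _∪_; _∩_; ⁅_⁆; ⋃; ∣_∣; ⊤)
  renaming (⊥ to ∅)
open import Data.Fin.Subset.Properties
  using (_∈?_; ∣p∣≤n; ∣⊤∣≡n; ∣⁅x⁆∣≡1; ∣⊥∣≡0; x∈⁅x⁆; x∈⁅y⁆⇒x≡y;
         p⊆q⇒∣p∣≤∣q∣; ∣p∩q∣≤∣q∣; p⊆p∪q; q⊆p∪q; x∈p∪q⁻; x∈p∩q⁻; ∩-distribˡ-∪; ∉⊥; ⊆-refl)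
open import Data.List using (List; []; _∷_; length; map; filter)
import Data.List as List
open import Data.List.Relation.Unary.All using (All; []; _∷_)
open import Data.List.Relation.Unary.AllPairs using (AllPairs; []; _∷_)
import Data.List.Relation.Unary.All as All
import Data.List.Relation.Unary.AllPairs as AllPairs
open import Data.List.Relation.Unary.Linked using ([-]; _∷_)
open import Data.List.Relation.Unary.Unique.Propositional using (Unique)
open import Data.Nat using (ℕ; zero; suc; _≤_; _<_; _+_; _*_; _∸_; z≤n; s≤s; s≤s⁻¹)
open import Data.Nat.Properties hiding (_≟_)
open import Data.Nat.Tactic.RingSolver using (solve-∀)
open import Data.Product using (Σ; ∃; _,_; proj₁; proj₂)
open import Data.Sum using (_⊎_; inj₁; inj₂)
open import Data.Vec using ([]; _∷_; tabulate)
open import Data.Vec.Properties using (lookup∘tabulate; lookup⇒[]=; []=⇒lookup)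
open import Function using (Equivalence)
open import Relation.Binary.PropositionalEquality
open import Relation.Nullary using (¬_; yes; no; ¬?; _×-dec_; decidable-stable)
open import Relation.Nullary.Decidable using (T?)

∣p∪q∣+∣p∩q∣ : ∀ {n} (p q : Subset n) → ∣ p ∪ q ∣ + ∣ p ∩ q ∣ ≡ ∣ p ∣ + ∣ q ∣
∣p∪q∣+∣p∩q∣ []            []            = refl
∣p∪q∣+∣p∩q∣ (outside ∷ p) (outside ∷ q) = ∣p∪q∣+∣p∩q∣ p q
∣p∪q∣+∣p∩q∣ (inside  ∷ p) (outside ∷ q) = cong suc (∣p∪q∣+∣p∩q∣ p q)
∣p∪q∣+∣p∩q∣ (outside ∷ p) (inside  ∷ q) =
  trans (cong suc (∣p∪q∣+∣p∩q∣ p q)) (sym (+-suc ∣ p ∣ ∣ q ∣))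
∣p∪q∣+∣p∩q∣ (inside  ∷ p) (inside  ∷ q) = cong suc (begin
  ∣ p ∪ q ∣ + suc ∣ p ∩ q ∣   ≡⟨ +-suc ∣ p ∪ q ∣ ∣ p ∩ q ∣ ⟩
  suc (∣ p ∪ q ∣ + ∣ p ∩ q ∣) ≡⟨ cong suc (∣p∪q∣+∣p∩q∣ p q) ⟩
  suc (∣ p ∣ + ∣ q ∣)         ≡⟨ +-suc ∣ p ∣ ∣ q ∣ ⟨
  ∣ p ∣ + suc ∣ q ∣           ∎)
  where open ≡-Reasoning

∣p∪q∣≤∣p∣+∣q∣ : ∀ {n} (p q : Subset n) → ∣ p ∪ q ∣ ≤ ∣ p ∣ + ∣ q ∣
∣p∪q∣≤∣p∣+∣q∣ p q = ≤-trans (m≤m+n ∣ p ∪ q ∣ ∣ p ∩ q ∣) (≤-reflexive (∣p∪q∣+∣p∩q∣ p q))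

∣p∩⋃∣≤ : ∀ {n} {X : Set} (A : X → Subset n) (p : Subset n) (t : ℕ) (xs : List X) →
         All (λ x → ∣ p ∩ A x ∣ ≤ t) xs → ∣ p ∩ ⋃ (map A xs) ∣ ≤ length xs * t
∣p∩⋃∣≤ {n} A p t []       []         = ≤-trans (∣p∩q∣≤∣q∣ p _) (≤-reflexive (∣⊥∣≡0 n))
∣p∩⋃∣≤ A p t (x ∷ xs) (px ∷ pxs) = begin
  ∣ p ∩ (A x ∪ U) ∣          ≡⟨ cong ∣_∣ (∩-distribˡ-∪ p (A x) U) ⟩
  ∣ (p ∩ A x) ∪ (p ∩ U) ∣    ≤⟨ ∣p∪q∣≤∣p∣+∣q∣ (p ∩ A x) (p ∩ U) ⟩
  ∣ p ∩ A x ∣ + ∣ p ∩ U ∣    ≤⟨ +-mono-≤ px (∣p∩⋃∣≤ A p t xs pxs) ⟩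
  t + length xs * t          ∎
  where
  open ≤-Reasoning
  U = ⋃ (map A xs)

suc-square : ∀ m → suc m * suc m ≡ suc (m * 2 + m * m)
suc-square = solve-∀

⋃-lower-bound : ∀ {n} {X : Set} (A : X → Subset n) (d : ℕ) (xs : List X) →
  AllPairs (λ x y → ∣ A x ∩ A y ∣ ≤ 2) xs → All (λ x → d ≤ ∣ A x ∣) xs →
  length xs * d ≤ ∣ ⋃ (map A xs) ∣ + length xs * length xs
⋃-lower-bound A d []       []                    []         = z≤n
⋃-lower-bound A d (x ∷ xs) (overlaps-x ∷ pairs) (d≤x ∷ ds) = begin
  d + m * d                             ≤⟨ +-mono-≤ d≤x (⋃-lower-bound A d xs pairs ds) ⟩
  ∣ A x ∣ + (∣ U ∣ + m * m)             ≡⟨ +-assoc ∣ A x ∣ ∣ U ∣ (m * m) ⟨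
  (∣ A x ∣ + ∣ U ∣) + m * m             ≡⟨ cong (_+ m * m) (∣p∪q∣+∣p∩q∣ (A x) U) ⟨
  (∣ A x ∪ U ∣ + ∣ A x ∩ U ∣) + m * m   ≤⟨ +-monoˡ-≤ (m * m) (+-monoʳ-≤ ∣ A x ∪ U ∣ shared) ⟩
  (∣ A x ∪ U ∣ + m * 2) + m * m         ≡⟨ +-assoc ∣ A x ∪ U ∣ (m * 2) (m * m) ⟩
  ∣ A x ∪ U ∣ + (m * 2 + m * m)         ≤⟨ +-monoʳ-≤ ∣ A x ∪ U ∣ (n≤1+n (m * 2 + m * m)) ⟩
  ∣ A x ∪ U ∣ + suc (m * 2 + m * m)     ≡⟨ cong (∣ A x ∪ U ∣ +_) (suc-square m) ⟨
  ∣ A x ∪ U ∣ + suc m * suc m           ∎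
  where
  open ≤-Reasoning
  m = length xs
  U = ⋃ (map A xs)
  shared : ∣ A x ∩ U ∣ ≤ m * 2
  shared = ∣p∩⋃∣≤ A (A x) 2 xs overlaps-x

outside-small-set : ∀ {n} (p : Subset n) → ∣ p ∣ < n → ∃ λ x → x ∉ p
outside-small-set {n} p ∣p∣<n with any? (λ x → ¬? (x ∈? p))
... | yes found  = found
... | no none    = ⊥-elim (<⇒≱ ∣p∣<n (begin
  n         ≡⟨ ∣⊤∣≡n n ⟨
  ∣ ⊤ {n} ∣ ≤⟨ p⊆q⇒∣p∣≤∣q∣ ⊤⊆p ⟩
  ∣ p ∣     ∎))
  where
  open ≤-Reasoning
  ⊤⊆p : ⊤ {n} ⊆ p
  ⊤⊆p {x} _ = decidable-stable (x ∈? p) (λ x∉p → none (x , x∉p))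

entries : ∀ {n} → List (Fin n) → Subset n
entries xs = ⋃ (map ⁅_⁆ xs)

∣entries∣≤length : ∀ {n} (xs : List (Fin n)) → ∣ entries xs ∣ ≤ length xs
∣entries∣≤length {n} []       = ≤-reflexive (∣⊥∣≡0 n)
∣entries∣≤length     (x ∷ xs) =
  ≤-trans (∣p∪q∣≤∣p∣+∣q∣ ⁅ x ⁆ (entries xs)) (+-mono-≤ (≤-reflexive (∣⁅x⁆∣≡1 x)) (∣entries∣≤length xs))

∉entries : ∀ {n} {u : Fin n} (xs : List (Fin n)) → u ∉ entries xs → All (u ≢_) xs
∉entries []       _     = []
∉entries (x ∷ xs) u∉x∷xs =
  (λ { refl → u∉x∷xs (p⊆p∪q (entries xs) (x∈⁅x⁆ x)) })
  ∷ ∉entries xs (λ u∈xs → u∉x∷xs (q⊆p∪q ⁅ x ⁆ (entries xs) u∈xs))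

fresh : ∀ {n} (xs : List (Fin n)) → length xs < n → ∃ λ u → All (u ≢_) xs
fresh xs short with outside-small-set (entries xs) (≤-<-trans (∣entries∣≤length xs) short)
... | u , u∉xs = u , ∉entries xs u∉xs

⋃⊆ : ∀ {n} {X : Set} (A : X → Subset n) (C : Subset n) (xs : List X) →
     All (λ x → A x ⊆ C) xs → ⋃ (map A xs) ⊆ C
⋃⊆ A C []       []           x∈∅ = ⊥-elim (∉⊥ x∈∅)
⋃⊆ A C (x ∷ xs) (Ax⊆C ∷ sub) y∈ with x∈p∪q⁻ (A x) (⋃ (map A xs)) y∈
... | inj₁ y∈Ax  = Ax⊆C y∈Ax
... | inj₂ y∈Axs = ⋃⊆ A C xs sub y∈Axs

-- Filtering a tabulated list by a boolean test keeps as many points as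
-- the subset defined by the test has; this links the list-based degree
-- of Defs with subset cardinalities.
length-filter≡∣tabulate∣ : ∀ {m k} (f : Fin m → Bool) (h : Fin k → Fin m) →
  length (filter (λ w → T? (f w)) (List.tabulate h)) ≡ ∣ tabulate (λ i → f (h i)) ∣
length-filter≡∣tabulate∣ {k = zero}  f h = refl
length-filter≡∣tabulate∣ {k = suc k} f h with f (h zero)
... | true  = cong suc (length-filter≡∣tabulate∣ f (λ i → h (suc i)))
... | false = length-filter≡∣tabulate∣ f (λ i → h (suc i))

module _ {n : ℕ} (G : Graph n) where
  open Graph G using (adj; loopless) renaming (sym to adj-symmetric)

  nbhd : Fin n → Subset n
  nbhd u = tabulate (adj u)

  N[_] : Fin n → Subset n
  N[ u ] = ⁅ u ⁆ ∪ nbhd u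

  adj-sym : ∀ {u v} → Adj G u v → Adj G v u
  adj-sym {u} {v} = subst T (adj-symmetric u v)

  adj⇒≢ : ∀ {u v} → Adj G u v → u ≢ v
  adj⇒≢ {u} u~u refl = subst T (loopless u) u~u

  ∈nbhd⁺ : ∀ {u x} → Adj G u x → x ∈ nbhd u
  ∈nbhd⁺ {u} {x} u~x =
    lookup⇒[]= x (nbhd u) (trans (lookup∘tabulate (adj u) x) (Equivalence.to T-≡ u~x))

  ∈nbhd⁻ : ∀ {u x} → x ∈ nbhd u → Adj G u x
  ∈nbhd⁻ {u} {x} x∈ =
    Equivalence.from T-≡ (trans (sym (lookup∘tabulate (adj u) x)) ([]=⇒lookup x∈))

  nbr∈N : ∀ {u x} → Adj G u x → x ∈ N[ u ]
  nbr∈N {u} u~x = q⊆p∪q ⁅ u ⁆ (nbhd u) (∈nbhd⁺ u~x)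

  ∈N⁻ : ∀ {u x} → x ∈ N[ u ] → x ≡ u ⊎ Adj G u x
  ∈N⁻ {u} x∈ with x∈p∪q⁻ ⁅ u ⁆ (nbhd u) x∈
  ... | inj₁ x∈u    = inj₁ (x∈⁅y⁆⇒x≡y u x∈u)
  ... | inj₂ x∈nbhd = inj₂ (∈nbhd⁻ x∈nbhd)

  -- Since G is loopless, ∣N[u]∣ = deg u + 1.
  ∣N[u]∣≡1+degree : ∀ u → ∣ N[ u ] ∣ ≡ suc (degree G u)
  ∣N[u]∣≡1+degree u = begin
    ∣ N[ u ] ∣                          ≡⟨ +-identityʳ ∣ N[ u ] ∣ ⟨
    ∣ N[ u ] ∣ + 0                      ≡⟨ cong (∣ N[ u ] ∣ +_) ∣u∩nbhd∣≡0 ⟨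
    ∣ N[ u ] ∣ + ∣ ⁅ u ⁆ ∩ nbhd u ∣     ≡⟨ ∣p∪q∣+∣p∩q∣ ⁅ u ⁆ (nbhd u) ⟩
    ∣ ⁅ u ⁆ ∣ + ∣ nbhd u ∣              ≡⟨ cong₂ _+_ (∣⁅x⁆∣≡1 u) ∣nbhd∣≡degree ⟩
    suc (degree G u)                    ∎
    where
    open ≡-Reasoning
    ∣nbhd∣≡degree : ∣ nbhd u ∣ ≡ degree G u
    ∣nbhd∣≡degree = sym (length-filter≡∣tabulate∣ (adj u) (λ i → i))
    loop-free : ⁅ u ⁆ ∩ nbhd u ⊆ ∅
    loop-free x∈ with x∈p∩q⁻ ⁅ u ⁆ (nbhd u) x∈
    ... | x∈u , x∈nbhd = ⊥-elim (adj⇒≢ (∈nbhd⁻ x∈nbhd) (sym (x∈⁅y⁆⇒x≡y u x∈u)))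
    ∣u∩nbhd∣≡0 : ∣ ⁅ u ⁆ ∩ nbhd u ∣ ≡ 0
    ∣u∩nbhd∣≡0 = n≤0⇒n≡0 (≤-trans (p⊆q⇒∣p∣≤∣q∣ loop-free) (≤-reflexive (∣⊥∣≡0 n)))

  degree<n : ∀ u → degree G u < n
  degree<n u = subst (_≤ n) (∣N[u]∣≡1+degree u) (∣p∣≤n N[ u ])

  no-triangle : ¬ Cycle G 3 → ∀ {a b c} → Adj G a b → Adj G b c → Adj G c a → ⊥
  no-triangle no-C₃ {a} {b} {c} a~b b~c c~a = no-C₃ (record
    { start = a ; rest = b ∷ c ∷ [] ; len = refl ; long = ≤-refl
    ; distinct = (adj⇒≢ a~b ∷ (λ a≡c → adj⇒≢ c~a (sym a≡c)) ∷ []) ∷ (adj⇒≢ b~c ∷ []) ∷ [] ∷ []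
    ; path = a~b ∷ b~c ∷ [-] ; closing = c~a })

  no-quadrilateral : ¬ Cycle G 4 → ∀ {a b c d} →
    Adj G a b → Adj G b c → Adj G c d → Adj G d a → a ≢ c → b ≢ d → ⊥
  no-quadrilateral no-C₄ {a} {b} {c} {d} a~b b~c c~d d~a a≢c b≢d = no-C₄ (record
    { start = a ; rest = b ∷ c ∷ d ∷ [] ; len = refl ; long = s≤s (s≤s (s≤s z≤n))
    ; distinct = (adj⇒≢ a~b ∷ a≢c ∷ (λ a≡d → adj⇒≢ d~a (sym a≡d)) ∷ [])
                 ∷ (adj⇒≢ b~c ∷ b≢d ∷ []) ∷ (adj⇒≢ c~d ∷ []) ∷ [] ∷ []
    ; path = a~b ∷ b~c ∷ c~d ∷ [-] ; closing = d~a })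

  -- If distinct u, v have a common neighbour a, then a is the only
  -- vertex in both closed neighbourhoods: any other one closes a
  -- triangle (if it is u or v) or a quadrilateral u a v b.
  common-neighbour-unique : ¬ Cycle G 3 → ¬ Cycle G 4 → ∀ {u v a b} → u ≢ v →
    Adj G u a → Adj G v a → b ≢ a → b ∈ N[ u ] → b ∈ N[ v ] → ⊥
  common-neighbour-unique no-C₃ no-C₄ u≢v u~a v~a b≢a b∈Nu b∈Nv with ∈N⁻ b∈Nu | ∈N⁻ b∈Nv
  ... | inj₁ refl | inj₁ refl = u≢v refl
  ... | inj₁ refl | inj₂ v~u  = no-triangle no-C₃ u~a (adj-sym v~a) v~u
  ... | inj₂ u~v  | inj₁ refl = no-triangle no-C₃ v~a (adj-sym u~a) u~v
  ... | inj₂ u~b  | inj₂ v~b  =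
    no-quadrilateral no-C₄ u~a (adj-sym v~a) v~b (adj-sym u~b) u≢v (λ a≡b → b≢a (sym a≡b))

  -- Hence two distinct closed neighbourhoods share at most two vertices:
  -- either they share a common neighbour a and nothing else, or every
  -- shared vertex is u or v.
  closed-nbhd-overlap : ¬ Cycle G 3 → ¬ Cycle G 4 → ∀ {u v} → u ≢ v → ∣ N[ u ] ∩ N[ v ] ∣ ≤ 2
  closed-nbhd-overlap no-C₃ no-C₄ {u} {v} u≢v
    with any? (λ a → (a ∈? N[ u ] ∩ N[ v ]) ×-dec (¬? (a ≟ u) ×-dec ¬? (a ≟ v)))
  ... | yes (a , a∈ , a≢u , a≢v) = begin
    ∣ N[ u ] ∩ N[ v ] ∣   ≤⟨ p⊆q⇒∣p∣≤∣q∣ only-a ⟩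
    ∣ ⁅ a ⁆ ∣             ≡⟨ ∣⁅x⁆∣≡1 a ⟩
    1                     ≤⟨ n≤1+n 1 ⟩
    2                     ∎
    where
    open ≤-Reasoning
    neighbour : ∀ {w} → a ∈ N[ w ] → a ≢ w → Adj G w a
    neighbour a∈Nw a≢w with ∈N⁻ a∈Nw
    ... | inj₁ a≡w = ⊥-elim (a≢w a≡w)
    ... | inj₂ w~a = w~a
    u~a : Adj G u a
    u~a = neighbour (proj₁ (x∈p∩q⁻ N[ u ] N[ v ] a∈)) a≢u
    v~a : Adj G v a
    v~a = neighbour (proj₂ (x∈p∩q⁻ N[ u ] N[ v ] a∈)) a≢v
    only-a : N[ u ] ∩ N[ v ] ⊆ ⁅ a ⁆
    only-a {b} b∈ with b ≟ a
    ... | yes refl = x∈⁅x⁆ b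
    ... | no b≢a   = ⊥-elim (common-neighbour-unique no-C₃ no-C₄ u≢v u~a v~a b≢a
                               (proj₁ (x∈p∩q⁻ N[ u ] N[ v ] b∈)) (proj₂ (x∈p∩q⁻ N[ u ] N[ v ] b∈)))
  ... | no none = begin
    ∣ N[ u ] ∩ N[ v ] ∣   ≤⟨ p⊆q⇒∣p∣≤∣q∣ only-u-v ⟩
    ∣ ⁅ u ⁆ ∪ ⁅ v ⁆ ∣     ≤⟨ ∣p∪q∣≤∣p∣+∣q∣ ⁅ u ⁆ ⁅ v ⁆ ⟩
    ∣ ⁅ u ⁆ ∣ + ∣ ⁅ v ⁆ ∣ ≡⟨ cong₂ _+_ (∣⁅x⁆∣≡1 u) (∣⁅x⁆∣≡1 v) ⟩
    2                     ∎
    where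
    open ≤-Reasoning
    only-u-v : N[ u ] ∩ N[ v ] ⊆ ⁅ u ⁆ ∪ ⁅ v ⁆
    only-u-v {b} b∈ with b ≟ u | b ≟ v
    ... | yes refl | _        = p⊆p∪q ⁅ v ⁆ (x∈⁅x⁆ b)
    ... | no _     | yes refl = q⊆p∪q ⁅ u ⁆ ⁅ v ⁆ (x∈⁅x⁆ b)
    ... | no b≢u   | no b≢v   = ⊥-elim (none (b , b∈ , b≢u , b≢v))

  module _ (S : Subset n) where

    record Force (C : Subset n) : Set where
      field
        forcer      : Fin n
        target      : Fin n
        target∈N    : target ∈ N[ forcer ]
        target∉C    : target ∉ C
        N⊆C+target  : N[ forcer ] ⊆ C ∪ ⁅ target ⁆

    -- If C contains S but misses a vertex that S eventually colours, then
    -- some force is available from C: follow the derivation of that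
    -- vertex back to the first force whose target lies outside C.
    force-available : ∀ {C v} → S ⊆ C → Coloured G S v → v ∉ C → Force C
    force-available S⊆C (initial v∈S) v∉C = ⊥-elim (v∉C (S⊆C v∈S))
    force-available {C} S⊆C (force {u} {w} u-coloured u~w others) w∉C with u ∈? C
    ... | no u∉C = force-available S⊆C u-coloured u∉C
    ... | yes u∈C with any? (λ x → T? (adj u x) ×-dec (¬? (x ≟ w) ×-dec ¬? (x ∈? C)))
    ...   | yes (x , u~x , x≢w , x∉C) = force-available S⊆C (others x u~x x≢w) x∉C
    ...   | no none = record
      { forcer = u ; target = w ; target∈N = nbr∈N u~w ; target∉C = w∉C ; N⊆C+target = N⊆ }
      where
      N⊆ : N[ u ] ⊆ C ∪ ⁅ w ⁆
      N⊆ {x} x∈N with ∈N⁻ x∈N | x ≟ w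
      ... | inj₁ refl | _        = p⊆p∪q ⁅ w ⁆ u∈C
      ... | inj₂ _    | yes refl = q⊆p∪q C ⁅ w ⁆ (x∈⁅x⁆ x)
      ... | inj₂ u~x  | no x≢w   =
        p⊆p∪q ⁅ w ⁆ (decidable-stable (x ∈? C) (λ x∉C → none (x , u~x , x≢w , x∉C)))

    record History (i : ℕ) : Set where
      field
        coloured  : Subset n
        forcers   : List (Fin n)
        S⊆C       : S ⊆ coloured
        size      : ∣ coloured ∣ ≤ ∣ S ∣ + i
        #forcers  : length forcers ≡ i
        distinct  : Unique forcers
        saturated : All (λ f → N[ f ] ⊆ coloured) forcers

    open History

    start : History 0
    start = record
      { coloured = S ; forcers = [] ; S⊆C = λ x∈S → x∈S ; size = m≤m+n ∣ S ∣ 0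
      ; #forcers = refl ; distinct = [] ; saturated = [] }

    extend : ∀ {i} (H : History i) (u : Fin n) (C′ : Subset n) →
      coloured H ⊆ C′ → ∣ C′ ∣ ≤ ∣ S ∣ + suc i → N[ u ] ⊆ C′ →
      All (u ≢_) (forcers H) → History (suc i)
    extend H u C′ C⊆C′ small N⊆C′ new = record
      { coloured = C′ ; forcers = u ∷ forcers H ; S⊆C = λ x∈S → C⊆C′ (S⊆C H x∈S)
      ; size = small ; #forcers = cong suc (#forcers H) ; distinct = new ∷ distinct H
      ; saturated = N⊆C′ ∷ All.map (λ N⊆C {x} x∈ → C⊆C′ (N⊆C x∈)) (saturated H) }

    -- While i < n the history can be extended: if some vertex is still
    -- uncoloured perform an available force, otherwise take as forcer
    -- any vertex not used yet.
    next : ZeroForcingSet G S → ∀ {i} → History i → i < n → History (suc i)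
    next zfs {i} H i<n with any? (λ v → ¬? (v ∈? coloured H))
    ... | yes (v , v∉C) = extend H forcer (coloured H ∪ ⁅ target ⁆) (p⊆p∪q ⁅ target ⁆)
      (begin
        ∣ coloured H ∪ ⁅ target ⁆ ∣      ≤⟨ ∣p∪q∣≤∣p∣+∣q∣ (coloured H) ⁅ target ⁆ ⟩
        ∣ coloured H ∣ + ∣ ⁅ target ⁆ ∣  ≤⟨ +-mono-≤ (size H) (≤-reflexive (∣⁅x⁆∣≡1 target)) ⟩
        (∣ S ∣ + i) + 1                  ≡⟨ +-assoc ∣ S ∣ i 1 ⟩
        ∣ S ∣ + (i + 1)                  ≡⟨ cong (∣ S ∣ +_) (+-comm i 1) ⟩
        ∣ S ∣ + suc i                    ∎)
      N⊆C+target
      (All.map (λ N⊆C forcer≡f → target∉C (N⊆C (subst (λ f → target ∈ N[ f ]) forcer≡f target∈N)))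
               (saturated H))
      where
      open ≤-Reasoning
      open Force (force-available (S⊆C H) (zfs v) v∉C)
    ... | no none with fresh (forcers H) (subst (_< n) (sym (#forcers H)) i<n)
    ...   | u , u-new = extend H u (coloured H) ⊆-refl
      (≤-trans (size H) (+-monoʳ-≤ ∣ S ∣ (n≤1+n i)))
      (λ {x} _ → decidable-stable (x ∈? coloured H) (λ x∉C → none (x , x∉C)))
      u-new

    history : ZeroForcingSet G S → ∀ i → i ≤ n → History i
    history zfs zero    _   = start
    history zfs (suc i) i<n = next zfs (history zfs i (<⇒≤ i<n)) i<n

    -- If G has no 3- or 4-cycles and minimum degree at
    -- least δ, every zero forcing set S satisfies m δ ≤ ∣S∣ + m² for all
    -- m ≤ n: after m steps the coloured set has at most ∣S∣ + m vertices
    -- and covers m closed neighbourhoods of size ≥ δ + 1 overlapping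
    -- pairwise in at most two vertices.
    zero-forcing-bound : ¬ Cycle G 3 → ¬ Cycle G 4 → ∀ δ → (∀ v → δ ≤ degree G v) →
      ZeroForcingSet G S → ∀ m → m ≤ n → m * δ ≤ ∣ S ∣ + m * m
    zero-forcing-bound no-C₃ no-C₄ δ min-deg zfs m m≤n = +-cancelˡ-≤ m (m * δ) (∣ S ∣ + m * m) (begin
      m + m * δ                     ≡⟨ *-suc m δ ⟨
      m * suc δ                     ≤⟨ covered ⟩
      ∣ ⋃ (map N[_] F) ∣ + m * m    ≤⟨ +-monoˡ-≤ (m * m) (p⊆q⇒∣p∣≤∣q∣ (⋃⊆ N[_] C F (saturated H))) ⟩
      ∣ C ∣ + m * m                 ≤⟨ +-monoˡ-≤ (m * m) (size H) ⟩
      (∣ S ∣ + m) + m * m           ≡⟨ cong (_+ m * m) (+-comm ∣ S ∣ m) ⟩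
      (m + ∣ S ∣) + m * m           ≡⟨ +-assoc m ∣ S ∣ (m * m) ⟩
      m + (∣ S ∣ + m * m)           ∎)
      where
      open ≤-Reasoning
      H = history zfs m m≤n
      F = forcers H
      C = coloured H
      large : ∀ f → suc δ ≤ ∣ N[ f ] ∣
      large f = subst (suc δ ≤_) (sym (∣N[u]∣≡1+degree f)) (s≤s (min-deg f))
      covered : m * suc δ ≤ ∣ ⋃ (map N[_] F) ∣ + m * m
      covered = subst (λ k → k * suc δ ≤ ∣ ⋃ (map N[_] F) ∣ + k * k) (#forcers H)
        (⋃-lower-bound N[_] (suc δ) F
          (AllPairs.map (closed-nbhd-overlap no-C₃ no-C₄) (distinct H)) (All.universal large F))

square-expansion : ∀ k → (3 + k) * (3 + k) ≡ 2 + (k * k + 2 * k + 2) + (4 * k + 5)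
square-expansion = solve-∀

closing-identity : ∀ k e →
  (k * (k * k + 2 * k + 2 + e) + (2 + (k * k + 2 * k + 2 + e))) + (2 + k) * (2 + k) + e
    ≡ (2 + k) * (2 + (k * k + 2 * k + 2 + e))
closing-identity = solve-∀

-- Arithmetic core of the theorem, for δ = D + 2 and m = k + 2.
closing-arithmetic : ∀ k s D → k * k + 2 * k + 2 ≤ D →
  (2 + k) * (2 + D) ≤ s + (2 + k) * (2 + k) → k * D + (2 + D) ≤ s
closing-arithmetic k s D D-large bound with m≤n⇒∃[o]m+o≡n D-large
... | e , refl = +-cancelʳ-≤ ((2 + k) * (2 + k)) (k * D + (2 + D)) s (begin
  k * D + (2 + D) + (2 + k) * (2 + k)       ≤⟨ m≤m+n _ e ⟩
  k * D + (2 + D) + (2 + k) * (2 + k) + e   ≡⟨ closing-identity k e ⟩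
  (2 + k) * (2 + D)                         ≤⟨ bound ⟩
  s + (2 + k) * (2 + k)                     ∎)
  where open ≤-Reasoning

degree-arithmetic : ∀ k s δ → (3 + k) * (3 + k) < δ →
  (2 + k) * δ ≤ s + (2 + k) * (2 + k) → k * (δ ∸ 2) + δ ≤ s
degree-arithmetic k s (suc (suc D)) g²<δ bound = closing-arithmetic k s D D-large bound
  where
  open ≤-Reasoning
  D-large : k * k + 2 * k + 2 ≤ D
  D-large = ≤-trans (n≤1+n _) (s≤s⁻¹ (begin
    2 + (k * k + 2 * k + 2)                 ≤⟨ m≤m+n _ (4 * k + 5) ⟩
    2 + (k * k + 2 * k + 2) + (4 * k + 5)   ≡⟨ square-expansion k ⟨
    (3 + k) * (3 + k)                       ≤⟨ s≤s⁻¹ g²<δ ⟩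
    suc D                                   ∎))
degree-arithmetic k s zero          ()          _
degree-arithmetic k s (suc zero)    (s≤s ())    _

-- The theorem, with δ₀ = g².  Writing g = k + 3, apply the main
-- estimate with m = g − 1 = k + 2 (possible since m < δ ≤ deg v < n)
-- and conclude by arithmetic.
proposition5 : ∀ (g : ℕ) → 6 < g →
    Σ ℕ λ δ₀ →
      ∀ (n : ℕ) (G : Graph n) (δ z : ℕ) →
        HasGirth G g → MinDegree G δ → δ₀ < δ →
        IsZeroForcingNumber G z →
        (g ∸ 3) * (δ ∸ 2) + δ ≤ z
proposition5 (suc zero)       (s≤s ())
proposition5 (suc (suc zero)) (s≤s (s≤s ()))
proposition5 (suc (suc (suc k))) 6<g = (3 + k) * (3 + k) , bound
  where
  bound : ∀ n (G : Graph n) δ z → HasGirth G (3 + k) → MinDegree G δ →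
    (3 + k) * (3 + k) < δ → IsZeroForcingNumber G z → k * (δ ∸ 2) + δ ≤ z
  bound n G δ z (_ , no-shorter) (min-deg , v , deg-v≡δ) g²<δ ((S , zfs , ∣S∣≡z) , _) =
    subst (k * (δ ∸ 2) + δ ≤_) ∣S∣≡z (degree-arithmetic k ∣ S ∣ δ g²<δ
      (zero-forcing-bound G S no-C₃ no-C₄ δ min-deg zfs (2 + k) m≤n))
    where
    no-C₃ : ¬ Cycle G 3
    no-C₃ = no-shorter 3 (≤-trans (s≤s (s≤s (s≤s (s≤s z≤n)))) 6<g)
    no-C₄ : ¬ Cycle G 4
    no-C₄ = no-shorter 4 (≤-trans (s≤s (s≤s (s≤s (s≤s (s≤s z≤n))))) 6<g)
    m≤n : 2 + k ≤ n
    m≤n = begin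
      2 + k               ≤⟨ n≤1+n (2 + k) ⟩
      3 + k               ≤⟨ m≤m*n (3 + k) (3 + k) ⟩
      (3 + k) * (3 + k)   <⟨ g²<δ ⟩
      δ                   ≡⟨ deg-v≡δ ⟨
      degree G v          <⟨ degree<n G v ⟩
      n                   ∎
      where open ≤-Reasoning
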